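{- For any three outcome classes $\mathcal{X},\mathcal{Y},\mathcal{Z}\in\{\mathcal{L},\mathcal{R},\mathcal{N},\mathcal{P},\mathcal{T}\}$, there exist scoring play games $G\in\mathcal{X}$ and $H\in\mathcal{Y}$ such that $G+_{\ell}H\in\mathcal{Z}$.
   Context: A scoring play game is defined recursively as $G=\{G^L\mid G^S\mid G^R\}$, where $G^L$ (Left's options) and $G^R$ (Right's options) are sets of scoring play games and $G^S\in\mathbb{R}$ is the current score; the base case is a game with $G^L=G^R=\emptyset$. All games are finite (finite depth and width game trees). Players alternate; a game ends when the player to move has no option. The Left final score $G_F^{SL}$ (resp. Right final score $G_F^{SR}$) is the score at the terminal position reached when Left (resp. Right) moves first and both play perfectly, Left maximising and Right minimising the final score. Let $L_>=\{G:G_F^{SL}>0\}$, $L_<=\{G:G_F^{SL}<0\}$, $L_==\{G:G_F^{SL}=0\}$, and $R_>,R_<,R_=$ analogously with $G_F^{SR}$. Outcome classes: $\mathcal{L}=(L_>\cap R_>)\cup(L_>\cap R_=)\cup(L_=\cap R_>)$, $\mathcal{R}=(L_<\cap R_<)\cup(L_<\cap R_=)\cup(L_=\cap R_<)$, $\mathcal{N}=L_>\cap R_<$, $\mathcal{P}=L_<\cap R_>$, $\mathcal{T}=L_=\cap R_=$. The disjunctive sum (long rule) is $G+_{\ell}H=\{G^L+_{\ell}H,\,G+_{\ell}H^L\mid G^S+H^S\mid G^R+_{\ell}H,\,G+_{\ell}H^R\}$, where $G^L+_{\ell}H=\{g+_{\ell}H:g\in G^L\}$ and commas denote union; the sum ends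 when the player to move has no move in any component. -}

module Defs where

open import Data.Integer using (ℤ; 0ℤ; _+_; _⊔_; _⊓_; _<_; _>_)
open import Data.List using (List; []; _∷_; _++_)
open import Data.Product using (_×_)
open import Data.Sum using (_⊎_)
open import Relation.Binary.PropositionalEquality using (_≡_)

data Game : Set where
  ⟨_∣_∣_⟩ : List Game → ℤ → List Game → Game

score : Game → ℤ
score ⟨ _ ∣ s ∣ _ ⟩ = s

-- Left final score (Left moves first) and Right final score (Right moves first).
mutual
  leftFinal : Game → ℤ
  leftFinal ⟨ [] ∣ s ∣ _ ⟩ = s
  leftFinal ⟨ g ∷ gs ∣ _ ∣ _ ⟩ = maxRightFinal g gs

  rightFinal : Game → ℤ
  rightFinal ⟨ _ ∣ s ∣ [] ⟩ = s
  rightFinal ⟨ _ ∣ _ ∣ g ∷ gs ⟩ = minLeftFinal g gs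

  maxRightFinal : Game → List Game → ℤ
  maxRightFinal g [] = rightFinal g
  maxRightFinal g (h ∷ hs) = rightFinal g ⊔ maxRightFinal h hs

  minLeftFinal : Game → List Game → ℤ
  minLeftFinal g [] = leftFinal g
  minLeftFinal g (h ∷ hs) = leftFinal g ⊓ minLeftFinal h hs

mutual
  _+ℓ_ : Game → Game → Game
  G@(⟨ GL ∣ s ∣ GR ⟩) +ℓ H@(⟨ HL ∣ t ∣ HR ⟩) =
    ⟨ sumL GL H ++ sumR G HL ∣ s + t ∣ sumL GR H ++ sumR G HR ⟩

  sumL : List Game → Game → List Game
  sumL [] H = []
  sumL (g ∷ gs) H = (g +ℓ H) ∷ sumL gs H

  sumR : Game → List Game → List Game
  sumR G [] = []
  sumR G (h ∷ hs) = (G +ℓ h) ∷ sumR G hs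

data Outcome : Set where
  𝓛 𝓡 𝓝 𝓟 𝓣 : Outcome

_∈O_ : Game → Outcome → Set
G ∈O 𝓛 = (leftFinal G > 0ℤ × rightFinal G > 0ℤ)
       ⊎ (leftFinal G > 0ℤ × rightFinal G ≡ 0ℤ)
       ⊎ (leftFinal G ≡ 0ℤ × rightFinal G > 0ℤ)
G ∈O 𝓡 = (leftFinal G < 0ℤ × rightFinal G < 0ℤ)
       ⊎ (leftFinal G < 0ℤ × rightFinal G ≡ 0ℤ)
       ⊎ (leftFinal G ≡ 0ℤ × rightFinal G < 0ℤ)
G ∈O 𝓝 = leftFinal G > 0ℤ × rightFinal G < 0ℤ
G ∈O 𝓟 = leftFinal G < 0ℤ × rightFinal G > 0ℤ
G ∈O 𝓣 = leftFinal G ≡ 0ℤ × rightFinal G ≡ 0ℤ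

{-# OPTIONS --safe #-}

-- Every witness can be taken among games in which each position has at most
-- one option, and its membership in the outcome classes is certified by
-- evaluating final scores. Conjugation (exchanging Left and Right and negating
-- every score) commutes with the long-rule sum and turns final scores (l, r)
-- into (-r, -l); hence it swaps 𝓛 and 𝓡 and fixes 𝓝, 𝓟 and 𝓣, so the
-- examples with G ∈ 𝓡 are the conjugates of those with G ∈ 𝓛.

module Submission where

open import Agda.Builtin.FromNat using (Number; fromNat)
open import Agda.Builtin.FromNeg using (Negative; fromNeg)
open import Data.Integer using (ℤ; 0ℤ; -_; _⊔_; _⊓_; _<?_; _≟_)
open import Data.Integer.Literals as ℤ using ()
open import Data.Integer.Properties using (neg-mono-<; neg-distrib-+; neg-distrib-⊓-⊔; neg-distrib-⊔-⊓)
open import Data.List using (List; []; _∷_; _++_; [_])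
open import Data.Product using (Σ; _×_; _,_)
open import Data.Sum using (inj₁; inj₂)
open import Data.Unit using (⊤)
open import Relation.Binary.PropositionalEquality using (_≡_; refl; cong; cong₂; trans; sym; subst)
open import Relation.Nullary.Decidable using (Dec; True; toWitness; _×-dec_; _⊎-dec_)

open import Defs

instance
  ℤ-number : Number ℤ
  ℤ-number = ℤ.number

  ℤ-negative : Negative ℤ
  ℤ-negative = ℤ.negative

mutual
  conjugate : Game → Game
  conjugate ⟨ GL ∣ s ∣ GR ⟩ = ⟨ conjugates GR ∣ - s ∣ conjugates GL ⟩

  conjugates : List Game → List Game
  conjugates []       = []
  conjugates (g ∷ gs) = conjugate g ∷ conjugates gs

conjugates-++ : ∀ xs ys → conjugates (xs ++ ys) ≡ conjugates xs ++ conjugates ys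
conjugates-++ []       ys = refl
conjugates-++ (x ∷ xs) ys = cong (conjugate x ∷_) (conjugates-++ xs ys)

mutual
  leftFinal-conjugate : ∀ G → leftFinal (conjugate G) ≡ - rightFinal G
  leftFinal-conjugate ⟨ _ ∣ _ ∣ []     ⟩ = refl
  leftFinal-conjugate ⟨ _ ∣ _ ∣ g ∷ gs ⟩ = maxRightFinal-conjugates g gs

  rightFinal-conjugate : ∀ G → rightFinal (conjugate G) ≡ - leftFinal G
  rightFinal-conjugate ⟨ []     ∣ _ ∣ _ ⟩ = refl
  rightFinal-conjugate ⟨ g ∷ gs ∣ _ ∣ _ ⟩ = minLeftFinal-conjugates g gs

  maxRightFinal-conjugates : ∀ g gs →
    maxRightFinal (conjugate g) (conjugates gs) ≡ - minLeftFinal g gs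
  maxRightFinal-conjugates g []       = rightFinal-conjugate g
  maxRightFinal-conjugates g (h ∷ hs) =
    trans (cong₂ _⊔_ (rightFinal-conjugate g) (maxRightFinal-conjugates h hs))
          (sym (neg-distrib-⊓-⊔ (leftFinal g) (minLeftFinal h hs)))

  minLeftFinal-conjugates : ∀ g gs →
    minLeftFinal (conjugate g) (conjugates gs) ≡ - maxRightFinal g gs
  minLeftFinal-conjugates g []       = leftFinal-conjugate g
  minLeftFinal-conjugates g (h ∷ hs) =
    trans (cong₂ _⊓_ (leftFinal-conjugate g) (minLeftFinal-conjugates h hs))
          (sym (neg-distrib-⊔-⊓ (rightFinal g) (maxRightFinal h hs)))

⟨∣∣⟩-cong : ∀ {L L′ s s′ R R′} → L ≡ L′ → s ≡ s′ → R ≡ R′ → ⟨ L ∣ s ∣ R ⟩ ≡ ⟨ L′ ∣ s′ ∣ R′ ⟩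
⟨∣∣⟩-cong refl refl refl = refl

mutual
  conjugate-+ℓ : ∀ G H → conjugate (G +ℓ H) ≡ conjugate G +ℓ conjugate H
  conjugate-+ℓ G@(⟨ GL ∣ s ∣ GR ⟩) H@(⟨ HL ∣ t ∣ HR ⟩) =
    ⟨∣∣⟩-cong (conjugates-options GR H G HR) (neg-distrib-+ s t) (conjugates-options GL H G HL)

  conjugates-options : ∀ gs H G hs →
    conjugates (sumL gs H ++ sumR G hs)
      ≡ sumL (conjugates gs) (conjugate H) ++ sumR (conjugate G) (conjugates hs)
  conjugates-options gs H G hs =
    trans (conjugates-++ (sumL gs H) (sumR G hs))
          (cong₂ _++_ (conjugates-sumL gs H) (conjugates-sumR G hs))

  conjugates-sumL : ∀ gs H → conjugates (sumL gs H) ≡ sumL (conjugates gs) (conjugate H)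
  conjugates-sumL []       H = refl
  conjugates-sumL (g ∷ gs) H = cong₂ _∷_ (conjugate-+ℓ g H) (conjugates-sumL gs H)

  conjugates-sumR : ∀ G hs → conjugates (sumR G hs) ≡ sumR (conjugate G) (conjugates hs)
  conjugates-sumR G []       = refl
  conjugates-sumR G (h ∷ hs) = cong₂ _∷_ (conjugate-+ℓ G h) (conjugates-sumR G hs)

mirror : Outcome → Outcome
mirror 𝓛 = 𝓡
mirror 𝓡 = 𝓛
mirror 𝓝 = 𝓝
mirror 𝓟 = 𝓟
mirror 𝓣 = 𝓣

conjugate-∈O : ∀ X {G} → G ∈O mirror X → conjugate G ∈O X
conjugate-∈O 𝓛 {G} (inj₁ (l<0 , r<0))
  rewrite leftFinal-conjugate G | rightFinal-conjugate G = inj₁ (neg-mono-< r<0 , neg-mono-< l<0)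
conjugate-∈O 𝓛 {G} (inj₂ (inj₁ (l<0 , r≡0)))
  rewrite leftFinal-conjugate G | rightFinal-conjugate G = inj₂ (inj₂ (cong -_ r≡0 , neg-mono-< l<0))
conjugate-∈O 𝓛 {G} (inj₂ (inj₂ (l≡0 , r<0)))
  rewrite leftFinal-conjugate G | rightFinal-conjugate G = inj₂ (inj₁ (neg-mono-< r<0 , cong -_ l≡0))
conjugate-∈O 𝓡 {G} (inj₁ (l>0 , r>0))
  rewrite leftFinal-conjugate G | rightFinal-conjugate G = inj₁ (neg-mono-< r>0 , neg-mono-< l>0)
conjugate-∈O 𝓡 {G} (inj₂ (inj₁ (l>0 , r≡0)))
  rewrite leftFinal-conjugate G | rightFinal-conjugate G = inj₂ (inj₂ (cong -_ r≡0 , neg-mono-< l>0))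
conjugate-∈O 𝓡 {G} (inj₂ (inj₂ (l≡0 , r>0)))
  rewrite leftFinal-conjugate G | rightFinal-conjugate G = inj₂ (inj₁ (neg-mono-< r>0 , cong -_ l≡0))
conjugate-∈O 𝓝 {G} (l>0 , r<0)
  rewrite leftFinal-conjugate G | rightFinal-conjugate G = neg-mono-< r<0 , neg-mono-< l>0
conjugate-∈O 𝓟 {G} (l<0 , r>0)
  rewrite leftFinal-conjugate G | rightFinal-conjugate G = neg-mono-< r>0 , neg-mono-< l<0
conjugate-∈O 𝓣 {G} (l≡0 , r≡0)
  rewrite leftFinal-conjugate G | rightFinal-conjugate G = cong -_ r≡0 , cong -_ l≡0

record Example (X Y Z : Outcome) : Set where
  constructor witness
  field
    G H   : Game
    G∈X   : G ∈O X
    H∈Y   : H ∈O Y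
    G+H∈Z : (G +ℓ H) ∈O Z

conjugate-example : ∀ {X Y Z} → Example (mirror X) (mirror Y) (mirror Z) → Example X Y Z
conjugate-example {X} {Y} {Z} (witness G H G∈ H∈ G+H∈) =
  witness (conjugate G) (conjugate H) (conjugate-∈O X G∈) (conjugate-∈O Y H∈)
    (subst (_∈O Z) (conjugate-+ℓ G H) (conjugate-∈O Z G+H∈))

_∈O?_ : (G : Game) (X : Outcome) → Dec (G ∈O X)
G ∈O? 𝓛 = ((0ℤ <? leftFinal G) ×-dec (0ℤ <? rightFinal G))
  ⊎-dec (((0ℤ <? leftFinal G) ×-dec (rightFinal G ≟ 0ℤ))
  ⊎-dec ((leftFinal G ≟ 0ℤ) ×-dec (0ℤ <? rightFinal G)))
G ∈O? 𝓡 = ((leftFinal G <? 0ℤ) ×-dec (rightFinal G <? 0ℤ))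
  ⊎-dec (((leftFinal G <? 0ℤ) ×-dec (rightFinal G ≟ 0ℤ))
  ⊎-dec ((leftFinal G ≟ 0ℤ) ×-dec (rightFinal G <? 0ℤ)))
G ∈O? 𝓝 = (0ℤ <? leftFinal G) ×-dec (rightFinal G <? 0ℤ)
G ∈O? 𝓟 = (leftFinal G <? 0ℤ) ×-dec (0ℤ <? rightFinal G)
G ∈O? 𝓣 = (leftFinal G ≟ 0ℤ) ×-dec (rightFinal G ≟ 0ℤ)

example : ∀ {X Y Z} G H
  {_ : True (G ∈O? X)} {_ : True (H ∈O? Y)} {_ : True ((G +ℓ H) ∈O? Z)} → Example X Y Z
example G H {G∈} {H∈} {G+H∈} = witness G H (toWitness G∈) (toWitness H∈) (toWitness G+H∈)

num : ℤ → Game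
num s = ⟨ [] ∣ s ∣ [] ⟩

infixl 5 _◁_
infixr 5 _▷_

_◁_ : Game → ℤ → Game
g ◁ s = ⟨ [ g ] ∣ s ∣ [] ⟩

_▷_ : ℤ → Game → Game
s ▷ g = ⟨ [] ∣ s ∣ [ g ] ⟩

examples-𝓛 : ∀ Y Z → Example 𝓛 Y Z
examples-𝓛 𝓛 𝓛 = example (num 1)            (num 1)
examples-𝓛 𝓛 𝓡 = example (num 0 ◁ 1)        (1 ▷ 0 ▷ num -1)
examples-𝓛 𝓛 𝓝 = example (num 0 ◁ 1)        (0 ▷ 1 ▷ num -1)
examples-𝓛 𝓛 𝓟 = example (1 ▷ num 0)        ((-1 ▷ num 1) ◁ 0)
examples-𝓛 𝓛 𝓣 = example (num 0 ◁ 1)        (1 ▷ num 0)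
examples-𝓛 𝓡 𝓛 = example (num 2)            (num -1)
examples-𝓛 𝓡 𝓡 = example (num 1)            (num -2)
examples-𝓛 𝓡 𝓝 = example (num 1)            (num 0 ◁ -2)
examples-𝓛 𝓡 𝓟 = example (num 1)            (-2 ▷ num 0)
examples-𝓛 𝓡 𝓣 = example (num 1)            (num -1)
examples-𝓛 𝓝 𝓛 = example (num 1)            (num 1 ◁ -1)
examples-𝓛 𝓝 𝓡 = example (num 0 ◁ 1)        (1 ▷ num -1)
examples-𝓛 𝓝 𝓝 = example (num 1)            (num 1 ◁ -2)
examples-𝓛 𝓝 𝓟 = example (num 1 ◁ 0)        (1 ▷ -2 ▷ num 0)
examples-𝓛 𝓝 𝓣 = example (num 1 ◁ 0)        (1 ▷ num -1)
examples-𝓛 𝓟 𝓛 = example (num 1)            (-1 ▷ num 1)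
examples-𝓛 𝓟 𝓡 = example (0 ▷ num 1)        (-1 ▷ num 1)
examples-𝓛 𝓟 𝓝 = example (2 ▷ num 0)        (-1 ▷ num 1)
examples-𝓛 𝓟 𝓟 = example (num 1)            (-2 ▷ num 1)
examples-𝓛 𝓟 𝓣 = example (0 ▷ num 1)        (num -1 ◁ 1)
examples-𝓛 𝓣 𝓛 = example (num 1)            (num 0)
examples-𝓛 𝓣 𝓡 = example (num 0 ◁ 1)        (0 ▷ 0 ▷ num -1)
examples-𝓛 𝓣 𝓝 = example (0 ▷ 1 ▷ num -1)   (num 0 ◁ 0)
examples-𝓛 𝓣 𝓟 = example ((-1 ▷ num 1) ◁ 0) (0 ▷ num 0)
examples-𝓛 𝓣 𝓣 = example (0 ▷ num 1)        (0 ▷ num 0)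

examples-𝓝 : ∀ Y Z → Example 𝓝 Y Z
examples-𝓝 𝓛 𝓛 = example (num 1 ◁ -1)        (num 1)
examples-𝓝 𝓛 𝓡 = example (1 ▷ num -1)        (num 0 ◁ 1)
examples-𝓝 𝓛 𝓝 = example (num 1 ◁ -2)        (num 1)
examples-𝓝 𝓛 𝓟 = example (1 ▷ num -1)        ((0 ▷ num 2) ◁ 0)
examples-𝓝 𝓛 𝓣 = example (1 ▷ num -1)        (num 1 ◁ 0)
examples-𝓝 𝓡 𝓛 = example (num 1 ◁ -1)        (-1 ▷ num 0)
examples-𝓝 𝓡 𝓡 = example (num 1 ◁ -1)        (num -1)
examples-𝓝 𝓡 𝓝 = example (num 2 ◁ -1)        (num -1)
examples-𝓝 𝓡 𝓟 = example (num 1 ◁ -1)        (0 ▷ -2 ▷ num 0)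
examples-𝓝 𝓡 𝓣 = example (num 1 ◁ -1)        (0 ▷ num -1)
examples-𝓝 𝓝 𝓛 = example (1 ▷ num -1)        (1 ▷ num -1)
examples-𝓝 𝓝 𝓡 = example (num 1 ◁ -1)        (num 1 ◁ -1)
examples-𝓝 𝓝 𝓝 = example (num 1 ◁ -1)        (num 2 ◁ -1)
examples-𝓝 𝓝 𝓟 = example (num 1 ◁ -1)        (1 ▷ -2 ▷ num 0)
examples-𝓝 𝓝 𝓣 = example (num 1 ◁ -1)        (1 ▷ num -1)
examples-𝓝 𝓟 𝓛 = example (num 1 ◁ -1)        (-1 ▷ num 1)
examples-𝓝 𝓟 𝓡 = example (1 ▷ num -1)        (-1 ▷ num 1)
examples-𝓝 𝓟 𝓝 = example (num 1 ◁ -2)        (num -1 ◁ 1)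
examples-𝓝 𝓟 𝓟 = example ((0 ▷ num 1) ◁ -1)  (-2 ▷ num 1)
examples-𝓝 𝓟 𝓣 = example ((0 ▷ num 1) ◁ -1)  (num -1 ◁ 1)
examples-𝓝 𝓣 𝓛 = example (num 1 ◁ -1)        (0 ▷ num 0)
examples-𝓝 𝓣 𝓡 = example (1 ▷ num -1)        (num 0 ◁ 0)
examples-𝓝 𝓣 𝓝 = example (num 1 ◁ -1)        (num 0)
examples-𝓝 𝓣 𝓟 = example ((-1 ▷ num 1) ◁ -1) (0 ▷ num 0)
examples-𝓝 𝓣 𝓣 = example ((0 ▷ num 1) ◁ -1)  (0 ▷ 0 ▷ num 0)

examples-𝓟 : ∀ Y Z → Example 𝓟 Y Z
examples-𝓟 𝓛 𝓛 = example (-1 ▷ num 1)      (num 1)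
examples-𝓟 𝓛 𝓡 = example (-1 ▷ num 1)      (0 ▷ num 1)
examples-𝓟 𝓛 𝓝 = example (-1 ▷ num 1)      (2 ▷ num 0)
examples-𝓟 𝓛 𝓟 = example (-2 ▷ num 1)      (num 1)
examples-𝓟 𝓛 𝓣 = example (num -1 ◁ 1)      (0 ▷ num 1)
examples-𝓟 𝓡 𝓛 = example (-1 ▷ num 1)      (num 0 ◁ -1)
examples-𝓟 𝓡 𝓡 = example (-1 ▷ num 1)      (num -1)
examples-𝓟 𝓡 𝓝 = example (num -1 ◁ 1)      (num 0 ◁ -2)
examples-𝓟 𝓡 𝓟 = example (-1 ▷ num 2)      (num -1)
examples-𝓟 𝓡 𝓣 = example (-1 ▷ num 1)      (num -1 ◁ 0)
examples-𝓟 𝓝 𝓛 = example (-1 ▷ num 1)      (num 1 ◁ -1)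
examples-𝓟 𝓝 𝓡 = example (-1 ▷ num 1)      (1 ▷ num -1)
examples-𝓟 𝓝 𝓝 = example (-1 ▷ num 1)      (2 ▷ num -1)
examples-𝓟 𝓝 𝓟 = example (-2 ▷ num 1)      ((0 ▷ num 1) ◁ -1)
examples-𝓟 𝓝 𝓣 = example (-1 ▷ num 1)      (1 ▷ (num -1 ◁ 0))
examples-𝓟 𝓟 𝓛 = example (num -1 ◁ 1)      (num -1 ◁ 1)
examples-𝓟 𝓟 𝓡 = example (-1 ▷ num 1)      (-1 ▷ num 1)
examples-𝓟 𝓟 𝓝 = example (-1 ▷ num 1)      (num 0 ◁ -2 ◁ 1)
examples-𝓟 𝓟 𝓟 = example (-1 ▷ num 2)      (-1 ▷ num 2)
examples-𝓟 𝓟 𝓣 = example (-1 ▷ num 1)      (num -1 ◁ 1)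
examples-𝓟 𝓣 𝓛 = example (-1 ▷ num 1)      (num 0 ◁ 0)
examples-𝓟 𝓣 𝓡 = example (-1 ▷ num 1)      (0 ▷ num 0)
examples-𝓟 𝓣 𝓝 = example (-1 ▷ 1 ▷ num -1) (num 0 ◁ 0)
examples-𝓟 𝓣 𝓟 = example (-1 ▷ num 1)      (num 0)
examples-𝓟 𝓣 𝓣 = example (-1 ▷ 1 ▷ num 0)  (num 0 ◁ 0 ◁ 0)

examples-𝓣 : ∀ Y Z → Example 𝓣 Y Z
examples-𝓣 𝓛 𝓛 = example (num 0)         (num 1)
examples-𝓣 𝓛 𝓡 = example (num 0 ◁ 0)     (1 ▷ 0 ▷ num -1)
examples-𝓣 𝓛 𝓝 = example (num 0 ◁ 0)     (0 ▷ 1 ▷ num -1)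
examples-𝓣 𝓛 𝓟 = example (0 ▷ num 0)     ((-1 ▷ num 1) ◁ 0)
examples-𝓣 𝓛 𝓣 = example (num 0 ◁ 0)     (1 ▷ num 0)
examples-𝓣 𝓡 𝓛 = example (num 0 ◁ 0)     (-1 ▷ 0 ▷ num 1)
examples-𝓣 𝓡 𝓡 = example (num 0)         (num -1)
examples-𝓣 𝓡 𝓝 = example (0 ▷ num 0)     (num 1 ◁ -1 ◁ 0)
examples-𝓣 𝓡 𝓟 = example (num 0 ◁ 0)     (0 ▷ -1 ▷ num 1)
examples-𝓣 𝓡 𝓣 = example (num 0 ◁ 0)     (-1 ▷ num 0)
examples-𝓣 𝓝 𝓛 = example (0 ▷ num 0)     (num 1 ◁ -1)
examples-𝓣 𝓝 𝓡 = example (num 0 ◁ 0)     (1 ▷ num -1)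
examples-𝓣 𝓝 𝓝 = example (num 0)         (num 1 ◁ -1)
examples-𝓣 𝓝 𝓟 = example (num 0 ◁ 0)     (1 ▷ -1 ▷ num 1)
examples-𝓣 𝓝 𝓣 = example (num 0 ◁ 0 ◁ 0) (1 ▷ -1 ▷ num 0)
examples-𝓣 𝓟 𝓛 = example (num 0 ◁ 0)     (-1 ▷ num 1)
examples-𝓣 𝓟 𝓡 = example (0 ▷ num 0)     (-1 ▷ num 1)
examples-𝓣 𝓟 𝓝 = example (num 0 ◁ 0)     (-1 ▷ 1 ▷ num -1)
examples-𝓣 𝓟 𝓟 = example (num 0)         (-1 ▷ num 1)
examples-𝓣 𝓟 𝓣 = example (num 0 ◁ 0 ◁ 0) (-1 ▷ 1 ▷ num 0)
examples-𝓣 𝓣 𝓛 = example (num 0 ◁ 0)     (0 ▷ 0 ▷ num 1)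
examples-𝓣 𝓣 𝓡 = example (num 0 ◁ 0)     (0 ▷ 0 ▷ num -1)
examples-𝓣 𝓣 𝓝 = example (num 0 ◁ 0 ◁ 0) (0 ▷ 0 ▷ 1 ▷ num -1)
examples-𝓣 𝓣 𝓟 = example (num 0 ◁ 0 ◁ 0) (0 ▷ 0 ▷ -1 ▷ num 1)
examples-𝓣 𝓣 𝓣 = example (num 0)         (num 0)

examples : ∀ X Y Z → Example X Y Z
examples 𝓛 Y Z = examples-𝓛 Y Z
examples 𝓡 Y Z = conjugate-example (examples-𝓛 (mirror Y) (mirror Z))
examples 𝓝 Y Z = examples-𝓝 Y Z
examples 𝓟 Y Z = examples-𝓟 Y Z
examples 𝓣 Y Z = examples-𝓣 Y Z

mainTheorem4 : (X Y Z : Outcome) →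
    Σ Game λ G → Σ Game λ H → (G ∈O X) × (H ∈O Y) × ((G +ℓ H) ∈O Z)
mainTheorem4 X Y Z with examples X Y Z
... | witness G H G∈X H∈Y G+H∈Z = G , H , G∈X , H∈Y , G+H∈Z
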